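{- Let $\Gamma$ be a set of patterns and $\varphi$ a pattern. If $\Gamma \vdash \varphi$ in the proof system $\mathcal{P}$ described in the context (i.e. $\varphi$ is a $\Gamma$-theorem), then $\varphi$ is a global semantic consequence of $\Gamma$: for every structure $\mathcal{A}$, if $\mathcal{A}\models\gamma$ for every $\gamma\in\Gamma$, then $\mathcal{A}\models\varphi$.
   Context: Signature: pairwise disjoint sets $EVar=\{v_n:n\in\mathbb N\}$ (element variables), $SVar=\{V_n:n\in\mathbb N\}$ (set variables) and a set $\Sigma$ of constants. Patterns are generated by $\varphi ::= x \mid X \mid \sigma \mid \varphi\,\varphi \mid \varphi\to\varphi \mid \exists x.\varphi \mid \mu X.\varphi$ ($x\in EVar$, $X\in SVar$, $\sigma\in\Sigma$; $\varphi\,\psi$ is application, associating to the left and binding tightest; no positivity restriction on $\mu X.\varphi$). $\exists x$ binds $x$, $\mu X$ binds $X$; $FV(\varphi)$ is the set of free element and set variables. Abbreviations: $\bot:=\mu X.X$, $\neg\varphi:=\varphi\to\bot$, $\top:=\neg\bot$, $\varphi\vee\psi:=\neg\varphi\to\psi$, $\varphi\wedge\psi:=\neg(\neg\varphi\vee\neg\psi)$, $\varphi\leftrightarrow\psi:=(\varphi\to\psi)\wedge(\psi\to\varphi)$, $\forall x.\varphi:=\neg\exists x.\neg\varphi$. The scope of $\exists x.$ extends as far right as possible, so $\exists x.\psi\,\varphi$ means $\exists x.(\psi\,\varphi)$. Semantics: a structure $\mathcal A=(A,\cdot,(\sigma^{\mathcal A})_{\sigma\in\Sigma})$ has $A\neq\emptyset$,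 $\cdot:A\times A\to 2^A$, $\sigma^{\mathcal A}\subseteq A$; for $B,C\subseteq A$, $B\cdot C:=\bigcup_{b\in B,c\in C}b\cdot c$. A valuation $e$ sends element variables to elements of $A$ and set variables to subsets of $A$; $e[a/x]$, $e[B/X]$ are the updated valuations. $\bar e$: $\bar e(x)=\{e(x)\}$, $\bar e(X)=e(X)$, $\bar e(\sigma)=\sigma^{\mathcal A}$, $\bar e(\varphi\psi)=\bar e(\varphi)\cdot\bar e(\psi)$, $\bar e(\varphi\to\psi)=A\setminus(\bar e(\varphi)\setminus\bar e(\psi))$, $\bar e(\exists x.\varphi)=\bigcup_{a\in A}\overline{e[a/x]}(\varphi)$, $\bar e(\mu X.\varphi)=\bigcap\{B\subseteq A:\overline{e[B/X]}(\varphi)\subseteq B\}$. $\mathcal A\models\varphi$ means $\bar e(\varphi)=A$ for all valuations $e$. Substitution: $\varphi[\delta/x]$ (resp. $\varphi[\delta/X]$) replaces every free occurrence of $x$ (resp. $X$) in $\varphi$ by $\delta$. $x$ (resp. $X$) is free for $\delta$ in $\varphi$ if no free occurrence of $x$ (resp. $X$) in $\varphi$ lies within the scope $\theta$ of a subpattern $\exists z.\theta$ with $z\in FV(\delta)$ or of a subpattern $\mu Z.\theta$ with $Z\in FV(\delta)$. Positivity: $\varphi$ is positive in $X$ if every free occurrence of $X$ in $\varphi$ lies within the left argument of an even number (possibly zero) of implication subpatterns $\psi\to\chi$ of $\varphi$. Tautology: $\varphi$ is a tautology if for every structure with domain $A$ and every map $F$ from patterns to $2^A$ with $F(\bot)=\emptyset$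 and $F(\psi\to\chi)=A\setminus(F(\psi)\setminus F(\chi))$ for all $\psi,\chi$, one has $F(\varphi)=A$. Contexts: $C::=\Box\mid C\,\varphi\mid\varphi\,C$ ($\varphi$ a pattern); $C[\delta]$ is the pattern obtained by replacing $\Box$ by $\delta$. Proof system $\mathcal P$. Axioms: (Tautology) every tautology; ($\exists$-Quantifier) $\varphi[y/x]\to\exists x.\varphi$ if $x$ is free for the element variable $y$ in $\varphi$; (Propagation$_\bot$) $\varphi\,\bot\to\bot$ and $\bot\,\varphi\to\bot$; (Propagation$_\vee$) $(\varphi\vee\psi)\,\chi\to\varphi\,\chi\vee\psi\,\chi$ and $\chi\,(\varphi\vee\psi)\to\chi\,\varphi\vee\chi\,\psi$; (Propagation$_\exists$) $(\exists x.\varphi)\,\psi\to\exists x.(\varphi\,\psi)$ and $\psi\,(\exists x.\varphi)\to\exists x.(\psi\,\varphi)$ if $x\notin FV(\psi)$; (Pre-Fixpoint) $\varphi[\mu X.\varphi/X]\to\mu X.\varphi$ if $\varphi$ is positive in $X$ and $X$ is free for $\mu X.\varphi$ in $\varphi$; (Existence) $\exists x.x$; (Singleton Variable) $\neg(C_1[x\wedge\varphi]\wedge C_2[x\wedge\neg\varphi])$ for contexts $C_1,C_2$. Rules: (modus ponens) from $\varphi$ and $\varphi\to\psi$ infer $\psi$; ($\exists$-quantifier rule) from $\varphi\to\psi$ infer $\exists x.\varphi\to\psi$ if $x\notin FV(\psi)$; (framing) from $\varphi\to\psi$ infer $\varphi\,\chi\to\psi\,\chi$ and $\chi\,\varphi\to\chi\,\psi$;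 (Set Variable Substitution) from $\varphi$ infer $\varphi[\psi/X]$ if $X$ is free for $\psi$ in $\varphi$; (Knaster–Tarski) from $\varphi[\psi/X]\to\psi$ infer $\mu X.\varphi\to\psi$ if $X$ is free for $\psi$ in $\varphi$. The $\Gamma$-theorems are the smallest set of patterns containing all axioms and all elements of $\Gamma$ and closed under the rules; $\Gamma\vdash\varphi$ means $\varphi$ is a $\Gamma$-theorem. -}

module Defs where

open import Data.Nat using (ℕ; _≡ᵇ_)
open import Data.Bool using (Bool; true; false; if_then_else_; not; _∧_)
open import Data.Product using (Σ; _×_; ∃-syntax)
open import Data.Unit using (⊤)
open import Data.Empty renaming (⊥ to Empty)
open import Data.Sum using (_⊎_)
open import Relation.Nullary using (¬_)
open import Relation.Binary.PropositionalEquality using (_≡_; _≢_)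

EVar : Set
EVar = ℕ

SVar : Set
SVar = ℕ

infixl 9 _∙_
infixr 5 _⇒_

data Pattern (Sig : Set) : Set where
  evar : EVar → Pattern Sig
  svar : SVar → Pattern Sig
  sym  : Sig → Pattern Sig
  _∙_  : Pattern Sig → Pattern Sig → Pattern Sig
  _⇒_  : Pattern Sig → Pattern Sig → Pattern Sig
  ex   : EVar → Pattern Sig → Pattern Sig
  mu   : SVar → Pattern Sig → Pattern Sig

module _ {Sig : Set} where

  ⊥ᵖ : Pattern Sig
  ⊥ᵖ = mu 0 (svar 0)

  ¬ᵖ_ : Pattern Sig → Pattern Sig
  ¬ᵖ φ = φ ⇒ ⊥ᵖ

  ⊤ᵖ : Pattern Sig
  ⊤ᵖ = ¬ᵖ ⊥ᵖ

  _∨ᵖ_ : Pattern Sig → Pattern Sig → Pattern Sig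
  φ ∨ᵖ ψ = (¬ᵖ φ) ⇒ ψ

  _∧ᵖ_ : Pattern Sig → Pattern Sig → Pattern Sig
  φ ∧ᵖ ψ = ¬ᵖ ((¬ᵖ φ) ∨ᵖ (¬ᵖ ψ))

  EFree : EVar → Pattern Sig → Set
  EFree x (evar y)  = x ≡ y
  EFree x (svar _)  = Empty
  EFree x (sym _)   = Empty
  EFree x (φ ∙ ψ)   = EFree x φ ⊎ EFree x ψ
  EFree x (φ ⇒ ψ)   = EFree x φ ⊎ EFree x ψ
  EFree x (ex y φ)  = (y ≢ x) × EFree x φ
  EFree x (mu _ φ)  = EFree x φ

  SFree : SVar → Pattern Sig → Set
  SFree X (evar _)  = Empty
  SFree X (svar Y)  = X ≡ Y
  SFree X (sym _)   = Empty
  SFree X (φ ∙ ψ)   = SFree X φ ⊎ SFree X ψ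
  SFree X (φ ⇒ ψ)   = SFree X φ ⊎ SFree X ψ
  SFree X (ex _ φ)  = SFree X φ
  SFree X (mu Y φ)  = (Y ≢ X) × SFree X φ

  -- Substitution of free occurrences (no renaming; side conditions are
  -- expressed with the "free for" predicates below)

  esubst : EVar → Pattern Sig → Pattern Sig → Pattern Sig
  esubst x δ (evar y)  = if y ≡ᵇ x then δ else evar y
  esubst x δ (svar Y)  = svar Y
  esubst x δ (sym s)   = sym s
  esubst x δ (φ ∙ ψ)   = esubst x δ φ ∙ esubst x δ ψ
  esubst x δ (φ ⇒ ψ)   = esubst x δ φ ⇒ esubst x δ ψ
  esubst x δ (ex y φ)  = if y ≡ᵇ x then ex y φ else ex y (esubst x δ φ)
  esubst x δ (mu Y φ)  = mu Y (esubst x δ φ)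

  ssubst : SVar → Pattern Sig → Pattern Sig → Pattern Sig
  ssubst X δ (evar y)  = evar y
  ssubst X δ (svar Y)  = if Y ≡ᵇ X then δ else svar Y
  ssubst X δ (sym s)   = sym s
  ssubst X δ (φ ∙ ψ)   = ssubst X δ φ ∙ ssubst X δ ψ
  ssubst X δ (φ ⇒ ψ)   = ssubst X δ φ ⇒ ssubst X δ ψ
  ssubst X δ (ex y φ)  = ex y (ssubst X δ φ)
  ssubst X δ (mu Y φ)  = if Y ≡ᵇ X then mu Y φ else mu Y (ssubst X δ φ)

  EFreeFor : EVar → Pattern Sig → Pattern Sig → Set
  EFreeFor x δ (evar _)  = ⊤
  EFreeFor x δ (svar _)  = ⊤
  EFreeFor x δ (sym _)   = ⊤
  EFreeFor x δ (φ ∙ ψ)   = EFreeFor x δ φ × EFreeFor x δ ψ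
  EFreeFor x δ (φ ⇒ ψ)   = EFreeFor x δ φ × EFreeFor x δ ψ
  EFreeFor x δ (ex z φ)  =
    if z ≡ᵇ x then ⊤ else ((EFree x φ → ¬ EFree z δ) × EFreeFor x δ φ)
  EFreeFor x δ (mu Z φ)  = (EFree x φ → ¬ SFree Z δ) × EFreeFor x δ φ

  SFreeFor : SVar → Pattern Sig → Pattern Sig → Set
  SFreeFor X δ (evar _)  = ⊤
  SFreeFor X δ (svar _)  = ⊤
  SFreeFor X δ (sym _)   = ⊤
  SFreeFor X δ (φ ∙ ψ)   = SFreeFor X δ φ × SFreeFor X δ ψ
  SFreeFor X δ (φ ⇒ ψ)   = SFreeFor X δ φ × SFreeFor X δ ψ
  SFreeFor X δ (ex z φ)  = (SFree X φ → ¬ EFree z δ) × SFreeFor X δ φ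
  SFreeFor X δ (mu Z φ)  =
    if Z ≡ᵇ X then ⊤ else ((SFree X φ → ¬ SFree Z δ) × SFreeFor X δ φ)

  Positive Negative : SVar → Pattern Sig → Set
  Positive X (evar _)  = ⊤
  Positive X (svar _)  = ⊤
  Positive X (sym _)   = ⊤
  Positive X (φ ∙ ψ)   = Positive X φ × Positive X ψ
  Positive X (φ ⇒ ψ)   = Negative X φ × Positive X ψ
  Positive X (ex _ φ)  = Positive X φ
  Positive X (mu Y φ)  = if Y ≡ᵇ X then ⊤ else Positive X φ
  Negative X (evar _)  = ⊤
  Negative X (svar Y)  = X ≢ Y
  Negative X (sym _)   = ⊤
  Negative X (φ ∙ ψ)   = Negative X φ × Negative X ψ
  Negative X (φ ⇒ ψ)   = Positive X φ × Negative X ψ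
  Negative X (ex _ φ)  = Negative X φ
  Negative X (mu Y φ)  = if Y ≡ᵇ X then ⊤ else Negative X φ

  data Ctx : Set where
    □    : Ctx
    _·ₗ_ : Ctx → Pattern Sig → Ctx
    _·ᵣ_ : Pattern Sig → Ctx → Ctx

  plug : Ctx → Pattern Sig → Pattern Sig
  plug □ δ        = δ
  plug (C ·ₗ φ) δ = plug C δ ∙ φ
  plug (φ ·ᵣ C) δ = φ ∙ plug C δ

-- Semantics.  Subsets of the carrier A are functions A → Bool.

record Structure (Sig : Set) : Set₁ where
  field
    Carrier  : Set
    inhabit  : Carrier
    app      : Carrier → Carrier → Carrier → Bool  -- a · b ⊆ A
    interp   : Sig → Carrier → Bool

module _ {Sig : Set} (M : Structure Sig) where
  open Structure M

  record Valuation : Set where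
    field
      ev : EVar → Carrier
      sv : SVar → Carrier → Bool
  open Valuation

  _[_/ₑ_] : Valuation → Carrier → EVar → Valuation
  ev (e [ a /ₑ x ]) y = if y ≡ᵇ x then a else ev e y
  sv (e [ a /ₑ x ]) = sv e

  _[_/ₛ_] : Valuation → (Carrier → Bool) → SVar → Valuation
  ev (e [ B /ₛ X ]) = ev e
  sv (e [ B /ₛ X ]) Y = if Y ≡ᵇ X then B else sv e Y

  -- ⟦ φ ⟧ e a  means  a ∈ ē(φ)
  ⟦_⟧ : Pattern Sig → Valuation → Carrier → Set
  ⟦ evar x ⟧ e a = a ≡ ev e x
  ⟦ svar X ⟧ e a = sv e X a ≡ true
  ⟦ sym s  ⟧ e a = interp s a ≡ true
  ⟦ φ ∙ ψ  ⟧ e a = ∃[ b ] ∃[ c ] (⟦ φ ⟧ e b × ⟦ ψ ⟧ e c × app b c a ≡ true)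
  ⟦ φ ⇒ ψ  ⟧ e a = ¬ (⟦ φ ⟧ e a × ¬ ⟦ ψ ⟧ e a)       -- A ∖ (ē φ ∖ ē ψ)
  ⟦ ex x φ ⟧ e a = ∃[ b ] ⟦ φ ⟧ (e [ b /ₑ x ]) a
  ⟦ mu X φ ⟧ e a =
    (B : Carrier → Bool) →
    ((b : Carrier) → ⟦ φ ⟧ (e [ B /ₛ X ]) b → B b ≡ true) → B a ≡ true

  Valid : Pattern Sig → Set
  Valid φ = (e : Valuation) (a : Carrier) → ⟦ φ ⟧ e a

Tautology : {Sig : Set} → Pattern Sig → Set₁
Tautology {Sig} φ =
  (M : Structure Sig) (F : Pattern Sig → Structure.Carrier M → Bool) →
  (∀ a → F ⊥ᵖ a ≡ false) →
  (∀ ψ χ a → F (ψ ⇒ χ) a ≡ not (F ψ a ∧ not (F χ a))) →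
  ∀ a → F φ a ≡ true

data _⊢_ {Sig : Set} (Γ : Pattern Sig → Set) : Pattern Sig → Set₁ where
  hyp        : ∀ {φ} → Γ φ → Γ ⊢ φ
  taut       : ∀ {φ} → Tautology φ → Γ ⊢ φ
  ∃-quant    : ∀ {φ x y} → EFreeFor x (evar y) φ →
               Γ ⊢ (esubst x (evar y) φ ⇒ ex x φ)
  prop⊥ₗ     : ∀ {φ} → Γ ⊢ ((⊥ᵖ ∙ φ) ⇒ ⊥ᵖ)
  prop⊥ᵣ     : ∀ {φ} → Γ ⊢ ((φ ∙ ⊥ᵖ) ⇒ ⊥ᵖ)
  prop∨ₗ     : ∀ {φ ψ χ} → Γ ⊢ (((φ ∨ᵖ ψ) ∙ χ) ⇒ ((φ ∙ χ) ∨ᵖ (ψ ∙ χ)))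
  prop∨ᵣ     : ∀ {φ ψ χ} → Γ ⊢ ((χ ∙ (φ ∨ᵖ ψ)) ⇒ ((χ ∙ φ) ∨ᵖ (χ ∙ ψ)))
  prop∃ₗ     : ∀ {φ ψ x} → ¬ EFree x ψ →
               Γ ⊢ ((ex x φ ∙ ψ) ⇒ ex x (φ ∙ ψ))
  prop∃ᵣ     : ∀ {φ ψ x} → ¬ EFree x ψ →
               Γ ⊢ ((ψ ∙ ex x φ) ⇒ ex x (ψ ∙ φ))
  prefix     : ∀ {φ X} → Positive X φ → SFreeFor X (mu X φ) φ →
               Γ ⊢ (ssubst X (mu X φ) φ ⇒ mu X φ)
  existence  : ∀ {x} → Γ ⊢ ex x (evar x)
  singleton  : ∀ {x φ} (C₁ C₂ : Ctx) →
               Γ ⊢ (¬ᵖ (plug C₁ (evar x ∧ᵖ φ) ∧ᵖ plug C₂ (evar x ∧ᵖ (¬ᵖ φ))))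
  mp         : ∀ {φ ψ} → Γ ⊢ φ → Γ ⊢ (φ ⇒ ψ) → Γ ⊢ ψ
  ∃-rule     : ∀ {φ ψ x} → ¬ EFree x ψ → Γ ⊢ (φ ⇒ ψ) → Γ ⊢ (ex x φ ⇒ ψ)
  framingₗ   : ∀ {φ ψ χ} → Γ ⊢ (φ ⇒ ψ) → Γ ⊢ ((φ ∙ χ) ⇒ (ψ ∙ χ))
  framingᵣ   : ∀ {φ ψ χ} → Γ ⊢ (φ ⇒ ψ) → Γ ⊢ ((χ ∙ φ) ⇒ (χ ∙ ψ))
  set-subst  : ∀ {φ ψ X} → SFreeFor X ψ φ → Γ ⊢ φ → Γ ⊢ ssubst X ψ φ
  knaster-tarski : ∀ {φ ψ X} → SFreeFor X ψ φ →
               Γ ⊢ (ssubst X ψ φ ⇒ ψ) → Γ ⊢ (mu X φ ⇒ ψ)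

-- With excluded
-- middle every pattern has a Boolean characteristic function, so a pattern δ can be used as
-- the value of a set variable; the substitution lemmas then say that substituting δ for X
-- means evaluating under the valuation that sends X to the extension of δ, and the
-- side conditions "free for" are exactly what makes this valid.  Positivity gives
-- monotonicity of the extension in X, which makes the least pre-fixpoint a pre-fixpoint.
module Submission where

open import Level using (0ℓ)
open import Axiom.ExcludedMiddle using (ExcludedMiddle)
open import Axiom.DoubleNegationElimination using (em⇒dne)
open import Data.Nat using (_≡ᵇ_; _≟_)
open import Data.Nat.Properties using (≡ᵇ⇒≡; ≡⇒≡ᵇ)
open import Data.Bool using (Bool; true; false; not; _∧_; T)
open import Data.Bool.Properties using (T-≡)
open import Data.Empty using (⊥-elim)
open import Data.Product using (_×_; _,_; proj₁; proj₂; ∃-syntax)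
open import Data.Sum using (_⊎_; inj₁; inj₂; [_,_])
open import Function using (_∘_)
open import Function.Bundles using (Equivalence; mk⇔)
open import Relation.Nullary using (¬_; does; yes; no)
open import Relation.Nullary.Decidable using (dec-true; dec-false; does-⇔)
open import Relation.Unary using (Pred; _⊆′_; _≐′_)
open import Relation.Unary.Properties using (≐′-refl; ≐′-trans)
open import Relation.Binary.PropositionalEquality as ≡ using (_≡_; _≢_; refl; subst)
open import Defs hiding (⟦_⟧; _[_/ₑ_]; _[_/ₛ_])

≡ᵇ-refl : ∀ n → (n ≡ᵇ n) ≡ true
≡ᵇ-refl n = Equivalence.to T-≡ (≡⇒≡ᵇ n n refl)

≡ᵇ-true⇒≡ : ∀ {m n} → (m ≡ᵇ n) ≡ true → m ≡ n
≡ᵇ-true⇒≡ {m} {n} eq = ≡ᵇ⇒≡ m n (Equivalence.from T-≡ eq)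

≡ᵇ-false⇒≢ : ∀ {m n} → (m ≡ᵇ n) ≡ false → m ≢ n
≡ᵇ-false⇒≢ {m} eq refl = subst T eq (≡⇒≡ᵇ m m refl)

module Soundness (em : ExcludedMiddle 0ℓ) {Sig : Set} (M : Structure Sig) where
  open Structure M
  open Valuation

  dne : ∀ {P : Set} → ¬ ¬ P → P
  dne = em⇒dne em

  ⌊_⌋ : Set → Bool
  ⌊ P ⌋ = does (em {P})

  ⌊⌋-true : ∀ {P} → P → ⌊ P ⌋ ≡ true
  ⌊⌋-true = dec-true em

  ⌊⌋-false : ∀ {P} → ¬ P → ⌊ P ⌋ ≡ false
  ⌊⌋-false = dec-false em

  ⌊⌋-true⁻¹ : ∀ {P} → ⌊ P ⌋ ≡ true → P
  ⌊⌋-true⁻¹ {P} eq with em {P}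
  ... | yes p = p

  ⟦_⟧ : Pattern Sig → Valuation M → Pred Carrier 0ℓ
  ⟦_⟧ = Defs.⟦_⟧ M

  ⟦_⟧ᵇ : Pattern Sig → Valuation M → Carrier → Bool
  ⟦ φ ⟧ᵇ e a = ⌊ ⟦ φ ⟧ e a ⌋

  _[_/ₑ_] : Valuation M → Carrier → EVar → Valuation M
  _[_/ₑ_] = Defs._[_/ₑ_] M

  _[_/ₛ_] : Valuation M → (Carrier → Bool) → SVar → Valuation M
  _[_/ₛ_] = Defs._[_/ₛ_] M

  lookup-updateₑ : ∀ e a x → ev (e [ a /ₑ x ]) x ≡ a
  lookup-updateₑ e a x rewrite ≡ᵇ-refl x = refl

  lookup-updateₑ-≢ : ∀ e a {x y} → y ≢ x → ev (e [ a /ₑ x ]) y ≡ ev e y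
  lookup-updateₑ-≢ e a {x} {y} y≢x with y ≡ᵇ x in eq
  ... | true  = ⊥-elim (y≢x (≡ᵇ-true⇒≡ eq))
  ... | false = refl

  -- Agreement and substitution

  ∙-cong : ∀ {φ φ′ ψ ψ′ e e′} → ⟦ φ ⟧ e ≐′ ⟦ φ′ ⟧ e′ → ⟦ ψ ⟧ e ≐′ ⟦ ψ′ ⟧ e′ →
           ⟦ φ ∙ ψ ⟧ e ≐′ ⟦ φ′ ∙ ψ′ ⟧ e′
  ∙-cong (φ⊆ , φ⊇) (ψ⊆ , ψ⊇) =
    (λ _ (b , c , b∈φ , c∈ψ , bc∋a) → b , c , φ⊆ b b∈φ , ψ⊆ c c∈ψ , bc∋a) ,
    (λ _ (b , c , b∈φ , c∈ψ , bc∋a) → b , c , φ⊇ b b∈φ , ψ⊇ c c∈ψ , bc∋a)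

  ⇒-cong : ∀ {φ φ′ ψ ψ′ e e′} → ⟦ φ ⟧ e ≐′ ⟦ φ′ ⟧ e′ → ⟦ ψ ⟧ e ≐′ ⟦ ψ′ ⟧ e′ →
           ⟦ φ ⇒ ψ ⟧ e ≐′ ⟦ φ′ ⇒ ψ′ ⟧ e′
  ⇒-cong (φ⊆ , φ⊇) (ψ⊆ , ψ⊇) =
    (λ a h (a∈φ , a∉ψ) → h (φ⊇ a a∈φ , a∉ψ ∘ ψ⊆ a)) ,
    (λ a h (a∈φ , a∉ψ) → h (φ⊆ a a∈φ , a∉ψ ∘ ψ⊇ a))

  ex-cong : ∀ {x φ φ′ e e′} → (∀ b → ⟦ φ ⟧ (e [ b /ₑ x ]) ≐′ ⟦ φ′ ⟧ (e′ [ b /ₑ x ])) →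
            ⟦ ex x φ ⟧ e ≐′ ⟦ ex x φ′ ⟧ e′
  ex-cong h = (λ a (b , p) → b , proj₁ (h b) a p) , (λ a (b , p) → b , proj₂ (h b) a p)

  mu-cong : ∀ {X φ φ′ e e′} → (∀ B → ⟦ φ ⟧ (e [ B /ₛ X ]) ≐′ ⟦ φ′ ⟧ (e′ [ B /ₛ X ])) →
            ⟦ mu X φ ⟧ e ≐′ ⟦ mu X φ′ ⟧ e′
  mu-cong h =
    (λ a m B closed → m B (λ b p → closed b (proj₁ (h B) b p))) ,
    (λ a m B closed → m B (λ b p → closed b (proj₂ (h B) b p)))

  record AgreeOn (φ : Pattern Sig) (e e′ : Valuation M) : Set where
    constructor _,_
    field
      onEVar : ∀ x → EFree x φ → ev e x ≡ ev e′ x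
      onSVar : ∀ X → SFree X φ → ∀ a → sv e X a ≡ sv e′ X a

  agreeOn-⊆ : ∀ {φ χ e e′} → (∀ x → EFree x φ → EFree x χ) → (∀ X → SFree X φ → SFree X χ) →
              AgreeOn χ e e′ → AgreeOn φ e e′
  agreeOn-⊆ E⊆ S⊆ (onE , onS) = (λ x → onE x ∘ E⊆ x) , (λ X → onS X ∘ S⊆ X)

  agreeOn-ex : ∀ {y φ e e′} → AgreeOn (ex y φ) e e′ → ∀ b → AgreeOn φ (e [ b /ₑ y ]) (e′ [ b /ₑ y ])
  agreeOn-ex {y} {φ} {e} {e′} (onE , onS) b = onE′ , onS
    where
    onE′ : ∀ x → EFree x φ → ev (e [ b /ₑ y ]) x ≡ ev (e′ [ b /ₑ y ]) x
    onE′ x fx with x ≡ᵇ y in eq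
    ... | true  = refl
    ... | false = onE x ((λ y≡x → ≡ᵇ-false⇒≢ eq (≡.sym y≡x)) , fx)

  agreeOn-mu : ∀ {Y φ e e′} → AgreeOn (mu Y φ) e e′ → ∀ B → AgreeOn φ (e [ B /ₛ Y ]) (e′ [ B /ₛ Y ])
  agreeOn-mu {Y} {φ} {e} {e′} (onE , onS) B = onE , onS′
    where
    onS′ : ∀ X → SFree X φ → ∀ a → sv (e [ B /ₛ Y ]) X a ≡ sv (e′ [ B /ₛ Y ]) X a
    onS′ X fX a with X ≡ᵇ Y in eq
    ... | true  = refl
    ... | false = onS X ((λ Y≡X → ≡ᵇ-false⇒≢ eq (≡.sym Y≡X)) , fX) a

  ⟦⟧-agree : ∀ φ {e e′} → AgreeOn φ e e′ → ⟦ φ ⟧ e ≐′ ⟦ φ ⟧ e′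
  ⟦⟧-agree (evar x) (onE , _) =
    (λ a a≡x → ≡.trans a≡x (onE x refl)) , (λ a a≡x → ≡.trans a≡x (≡.sym (onE x refl)))
  ⟦⟧-agree (svar X) (_ , onS) =
    (λ a a∈X → ≡.trans (≡.sym (onS X refl a)) a∈X) , (λ a a∈X → ≡.trans (onS X refl a) a∈X)
  ⟦⟧-agree (sym s) _ = ≐′-refl
  ⟦⟧-agree (φ ∙ ψ) h =
    ∙-cong (⟦⟧-agree φ (agreeOn-⊆ (λ _ → inj₁) (λ _ → inj₁) h))
           (⟦⟧-agree ψ (agreeOn-⊆ (λ _ → inj₂) (λ _ → inj₂) h))
  ⟦⟧-agree (φ ⇒ ψ) h =
    ⇒-cong (⟦⟧-agree φ (agreeOn-⊆ (λ _ → inj₁) (λ _ → inj₁) h))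
           (⟦⟧-agree ψ (agreeOn-⊆ (λ _ → inj₂) (λ _ → inj₂) h))
  ⟦⟧-agree (ex y φ) h = ex-cong λ b → ⟦⟧-agree φ (agreeOn-ex h b)
  ⟦⟧-agree (mu Y φ) h = mu-cong λ B → ⟦⟧-agree φ (agreeOn-mu h B)

  ⟦⟧ᵇ-agree : ∀ φ {e e′} → AgreeOn φ e e′ → ∀ a → ⟦ φ ⟧ᵇ e a ≡ ⟦ φ ⟧ᵇ e′ a
  ⟦⟧ᵇ-agree φ h a = does-⇔ (mk⇔ (proj₁ (⟦⟧-agree φ h) a) (proj₂ (⟦⟧-agree φ h) a)) em em

  agreeOn-updateₑ-unused : ∀ {x φ} e b → ¬ EFree x φ → AgreeOn φ e (e [ b /ₑ x ])
  agreeOn-updateₑ-unused {x} {φ} e b x∉φ = onE , (λ _ _ _ → refl)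
    where
    onE : ∀ z → EFree z φ → ev e z ≡ ev (e [ b /ₑ x ]) z
    onE z z∈φ = ≡.sym (lookup-updateₑ-≢ e b (λ z≡x → x∉φ (subst (λ w → EFree w φ) z≡x z∈φ)))

  agreeOn-updateₛ-unused : ∀ {X φ} e B → ¬ SFree X φ → AgreeOn φ e (e [ B /ₛ X ])
  agreeOn-updateₛ-unused {X} {φ} e B X∉φ = (λ _ _ → refl) , onS
    where
    onS : ∀ Z → SFree Z φ → ∀ a → sv e Z a ≡ sv (e [ B /ₛ X ]) Z a
    onS Z Z∈φ a with Z ≡ᵇ X in eq
    ... | true  = ⊥-elim (X∉φ (subst (λ W → SFree W φ) (≡ᵇ-true⇒≡ eq) Z∈φ))
    ... | false = refl

  agreeOn-updateₑ-cong : ∀ {x φ a a′} e → (EFree x φ → a ≡ a′) → AgreeOn φ (e [ a /ₑ x ]) (e [ a′ /ₑ x ])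
  agreeOn-updateₑ-cong {x} {φ} {a} {a′} e a≡a′ = onE , (λ _ _ _ → refl)
    where
    onE : ∀ z → EFree z φ → ev (e [ a /ₑ x ]) z ≡ ev (e [ a′ /ₑ x ]) z
    onE z z∈φ with z ≡ᵇ x in eq
    ... | true  = a≡a′ (subst (λ w → EFree w φ) (≡ᵇ-true⇒≡ eq) z∈φ)
    ... | false = refl

  agreeOn-updateₛ-cong : ∀ {X φ B B′} e → (SFree X φ → ∀ c → B c ≡ B′ c) →
                         AgreeOn φ (e [ B /ₛ X ]) (e [ B′ /ₛ X ])
  agreeOn-updateₛ-cong {X} {φ} {B} {B′} e B≗B′ = (λ _ _ → refl) , onS
    where
    onS : ∀ Z → SFree Z φ → ∀ c → sv (e [ B /ₛ X ]) Z c ≡ sv (e [ B′ /ₛ X ]) Z c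
    onS Z Z∈φ c with Z ≡ᵇ X in eq
    ... | true  = B≗B′ (subst (λ W → SFree W φ) (≡ᵇ-true⇒≡ eq) Z∈φ) c
    ... | false = refl

  agreeOn-updateₑ-comm : ∀ {x y φ a b} e → x ≢ y →
                         AgreeOn φ ((e [ a /ₑ x ]) [ b /ₑ y ]) ((e [ b /ₑ y ]) [ a /ₑ x ])
  agreeOn-updateₑ-comm {x} {y} {φ} {a} {b} e x≢y = onE , (λ _ _ _ → refl)
    where
    onE : ∀ z → EFree z φ → ev ((e [ a /ₑ x ]) [ b /ₑ y ]) z ≡ ev ((e [ b /ₑ y ]) [ a /ₑ x ]) z
    onE z _ with z ≡ᵇ y in eqy | z ≡ᵇ x in eqx
    ... | true  | true  = ⊥-elim (x≢y (≡.trans (≡.sym (≡ᵇ-true⇒≡ {z} eqx)) (≡ᵇ-true⇒≡ {z} eqy)))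
    ... | true  | false = refl
    ... | false | true  = refl
    ... | false | false = refl

  agreeOn-updateₛ-comm : ∀ {X Y φ B C} e → X ≢ Y →
                         AgreeOn φ ((e [ B /ₛ X ]) [ C /ₛ Y ]) ((e [ C /ₛ Y ]) [ B /ₛ X ])
  agreeOn-updateₛ-comm {X} {Y} {φ} {B} {C} e X≢Y = (λ _ _ → refl) , onS
    where
    onS : ∀ Z → SFree Z φ → ∀ c → sv ((e [ B /ₛ X ]) [ C /ₛ Y ]) Z c ≡ sv ((e [ C /ₛ Y ]) [ B /ₛ X ]) Z c
    onS Z _ c with Z ≡ᵇ Y in eqY | Z ≡ᵇ X in eqX
    ... | true  | true  = ⊥-elim (X≢Y (≡.trans (≡.sym (≡ᵇ-true⇒≡ {Z} eqX)) (≡ᵇ-true⇒≡ {Z} eqY)))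
    ... | true  | false = refl
    ... | false | true  = refl
    ... | false | false = refl

  ⟦⟧-esubst : ∀ φ x y e → EFreeFor x (evar y) φ →
              ⟦ esubst x (evar y) φ ⟧ e ≐′ ⟦ φ ⟧ (e [ ev e y /ₑ x ])
  ⟦⟧-esubst (evar z) x y e _ with z ≡ᵇ x
  ... | true  = ≐′-refl
  ... | false = ≐′-refl
  ⟦⟧-esubst (svar Y) x y e _ = ≐′-refl
  ⟦⟧-esubst (sym s) x y e _ = ≐′-refl
  ⟦⟧-esubst (φ ∙ ψ) x y e (fφ , fψ) = ∙-cong (⟦⟧-esubst φ x y e fφ) (⟦⟧-esubst ψ x y e fψ)
  ⟦⟧-esubst (φ ⇒ ψ) x y e (fφ , fψ) = ⇒-cong (⟦⟧-esubst φ x y e fφ) (⟦⟧-esubst ψ x y e fψ)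
  ⟦⟧-esubst (ex z φ) x y e f with z ≡ᵇ x in eq
  ... | true  = ⟦⟧-agree (ex z φ) (agreeOn-updateₑ-unused e (ev e y) (λ (z≢x , _) → z≢x (≡ᵇ-true⇒≡ eq)))
  ... | false = ex-cong λ b →
    ≐′-trans (⟦⟧-esubst φ x y (e [ b /ₑ z ]) (proj₂ f))
    (≐′-trans (⟦⟧-agree φ (agreeOn-updateₑ-cong (e [ b /ₑ z ])
                             λ x∈φ → lookup-updateₑ-≢ e b (proj₁ f x∈φ ∘ ≡.sym)))
              (⟦⟧-agree φ (agreeOn-updateₑ-comm e (≡ᵇ-false⇒≢ eq))))
  ⟦⟧-esubst (mu Z φ) x y e (_ , f) = mu-cong λ C → ⟦⟧-esubst φ x y (e [ C /ₛ Z ]) f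

  ⟦⟧-ssubst : ∀ φ X δ e → SFreeFor X δ φ → ⟦ ssubst X δ φ ⟧ e ≐′ ⟦ φ ⟧ (e [ ⟦ δ ⟧ᵇ e /ₛ X ])
  ⟦⟧-ssubst (evar y) X δ e _ = ≐′-refl
  ⟦⟧-ssubst (svar Y) X δ e _ with Y ≡ᵇ X
  ... | true  = (λ _ → ⌊⌋-true) , (λ _ → ⌊⌋-true⁻¹)
  ... | false = ≐′-refl
  ⟦⟧-ssubst (sym s) X δ e _ = ≐′-refl
  ⟦⟧-ssubst (φ ∙ ψ) X δ e (fφ , fψ) = ∙-cong (⟦⟧-ssubst φ X δ e fφ) (⟦⟧-ssubst ψ X δ e fψ)
  ⟦⟧-ssubst (φ ⇒ ψ) X δ e (fφ , fψ) = ⇒-cong (⟦⟧-ssubst φ X δ e fφ) (⟦⟧-ssubst ψ X δ e fψ)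
  ⟦⟧-ssubst (ex y φ) X δ e (y∉δ , f) = ex-cong λ b →
    ≐′-trans (⟦⟧-ssubst φ X δ (e [ b /ₑ y ]) f)
             (⟦⟧-agree φ (agreeOn-updateₛ-cong (e [ b /ₑ y ]) λ X∈φ →
                ≡.sym ∘ ⟦⟧ᵇ-agree δ (agreeOn-updateₑ-unused e b (y∉δ X∈φ))))
  ⟦⟧-ssubst (mu Y φ) X δ e f with Y ≡ᵇ X in eq
  ... | true  = ⟦⟧-agree (mu Y φ) (agreeOn-updateₛ-unused e (⟦ δ ⟧ᵇ e) (λ (Y≢X , _) → Y≢X (≡ᵇ-true⇒≡ eq)))
  ... | false = mu-cong λ C →
    ≐′-trans (⟦⟧-ssubst φ X δ (e [ C /ₛ Y ]) (proj₂ f))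
    (≐′-trans (⟦⟧-agree φ (agreeOn-updateₛ-cong (e [ C /ₛ Y ]) λ X∈φ →
                             ≡.sym ∘ ⟦⟧ᵇ-agree δ (agreeOn-updateₛ-unused e C (proj₁ f X∈φ))))
              (⟦⟧-agree φ (agreeOn-updateₛ-comm e (≡ᵇ-false⇒≢ eq))))

  -- Monotonicity in a positively occurring set variable

  _⊆ᵇ_ : (Carrier → Bool) → (Carrier → Bool) → Set
  B ⊆ᵇ B′ = ∀ a → B a ≡ true → B′ a ≡ true

  _⊑[_]_ : Valuation M → SVar → Valuation M → Set
  e ⊑[ X ] e′ = (∀ x → ev e x ≡ ev e′ x) ×
                (∀ Y → Y ≢ X → ∀ a → sv e Y a ≡ sv e′ Y a) ×
                sv e X ⊆ᵇ sv e′ X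

  ⊑-enlarge : ∀ {B B′} e X → B ⊆ᵇ B′ → (e [ B /ₛ X ]) ⊑[ X ] (e [ B′ /ₛ X ])
  ⊑-enlarge {B} {B′} e X B⊆B′ = (λ _ → refl) , onOthers , onX
    where
    onOthers : ∀ Y → Y ≢ X → ∀ a → sv (e [ B /ₛ X ]) Y a ≡ sv (e [ B′ /ₛ X ]) Y a
    onOthers Y Y≢X a with Y ≡ᵇ X in eq
    ... | true  = ⊥-elim (Y≢X (≡ᵇ-true⇒≡ eq))
    ... | false = refl
    onX : sv (e [ B /ₛ X ]) X ⊆ᵇ sv (e [ B′ /ₛ X ]) X
    onX rewrite ≡ᵇ-refl X = B⊆B′

  ⊑-updateₑ : ∀ {X e e′} y b → e ⊑[ X ] e′ → (e [ b /ₑ y ]) ⊑[ X ] (e′ [ b /ₑ y ])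
  ⊑-updateₑ {X} {e} {e′} y b (onE , onOthers , onX) = onE′ , onOthers , onX
    where
    onE′ : ∀ x → ev (e [ b /ₑ y ]) x ≡ ev (e′ [ b /ₑ y ]) x
    onE′ x with x ≡ᵇ y
    ... | true  = refl
    ... | false = onE x

  ⊑-updateₛ : ∀ {X e e′} Y C → Y ≢ X → e ⊑[ X ] e′ → (e [ C /ₛ Y ]) ⊑[ X ] (e′ [ C /ₛ Y ])
  ⊑-updateₛ {X} {e} {e′} Y C Y≢X (onE , onOthers , onX) = onE , onOthers′ , onX′
    where
    onOthers′ : ∀ Z → Z ≢ X → ∀ a → sv (e [ C /ₛ Y ]) Z a ≡ sv (e′ [ C /ₛ Y ]) Z a
    onOthers′ Z Z≢X a with Z ≡ᵇ Y
    ... | true  = refl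
    ... | false = onOthers Z Z≢X a
    onX′ : sv (e [ C /ₛ Y ]) X ⊆ᵇ sv (e′ [ C /ₛ Y ]) X
    onX′ with X ≡ᵇ Y in eq
    ... | true  = ⊥-elim (Y≢X (≡.sym (≡ᵇ-true⇒≡ eq)))
    ... | false = onX

  ⊑⇒agreeOn : ∀ {X e e′} φ → e ⊑[ X ] e′ → ¬ SFree X φ → AgreeOn φ e e′
  ⊑⇒agreeOn {X} φ (onE , onOthers , _) X∉φ =
    (λ x _ → onE x) , (λ Z Z∈φ → onOthers Z (λ Z≡X → X∉φ (subst (λ W → SFree W φ) Z≡X Z∈φ)))

  mutual
    ⟦⟧-monotone : ∀ φ X {e e′} → Positive X φ → e ⊑[ X ] e′ → ⟦ φ ⟧ e ⊆′ ⟦ φ ⟧ e′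
    ⟦⟧-monotone (evar x) X _ (onE , _) a a≡x = ≡.trans a≡x (onE x)
    ⟦⟧-monotone (svar Y) X _ (_ , onOthers , onX) a a∈Y with Y ≟ X
    ... | yes refl = onX a a∈Y
    ... | no Y≢X   = ≡.trans (≡.sym (onOthers Y Y≢X a)) a∈Y
    ⟦⟧-monotone (sym s) X _ _ a a∈s = a∈s
    ⟦⟧-monotone (φ ∙ ψ) X (pφ , pψ) e⊑e′ a (b , c , b∈φ , c∈ψ , bc∋a) =
      b , c , ⟦⟧-monotone φ X pφ e⊑e′ b b∈φ , ⟦⟧-monotone ψ X pψ e⊑e′ c c∈ψ , bc∋a
    ⟦⟧-monotone (φ ⇒ ψ) X (nφ , pψ) e⊑e′ a h (a∈φ , a∉ψ) =
      h (⟦⟧-antitone φ X nφ e⊑e′ a a∈φ , a∉ψ ∘ ⟦⟧-monotone ψ X pψ e⊑e′ a)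
    ⟦⟧-monotone (ex y φ) X pφ e⊑e′ a (b , a∈φ) =
      b , ⟦⟧-monotone φ X pφ (⊑-updateₑ y b e⊑e′) a a∈φ
    ⟦⟧-monotone (mu Y φ) X pφ e⊑e′ with Y ≡ᵇ X in eq
    ... | true  = proj₁ (⟦⟧-agree (mu Y φ) (⊑⇒agreeOn (mu Y φ) e⊑e′ λ (Y≢X , _) → Y≢X (≡ᵇ-true⇒≡ eq)))
    ... | false = λ a m B closed → m B λ b b∈φ →
      closed b (⟦⟧-monotone φ X pφ (⊑-updateₛ Y B (≡ᵇ-false⇒≢ eq) e⊑e′) b b∈φ)

    ⟦⟧-antitone : ∀ φ X {e e′} → Negative X φ → e ⊑[ X ] e′ → ⟦ φ ⟧ e′ ⊆′ ⟦ φ ⟧ e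
    ⟦⟧-antitone (evar x) X _ (onE , _) a a≡x = ≡.trans a≡x (≡.sym (onE x))
    ⟦⟧-antitone (svar Y) X X≢Y (_ , onOthers , _) a a∈Y = ≡.trans (onOthers Y (X≢Y ∘ ≡.sym) a) a∈Y
    ⟦⟧-antitone (sym s) X _ _ a a∈s = a∈s
    ⟦⟧-antitone (φ ∙ ψ) X (nφ , nψ) e⊑e′ a (b , c , b∈φ , c∈ψ , bc∋a) =
      b , c , ⟦⟧-antitone φ X nφ e⊑e′ b b∈φ , ⟦⟧-antitone ψ X nψ e⊑e′ c c∈ψ , bc∋a
    ⟦⟧-antitone (φ ⇒ ψ) X (pφ , nψ) e⊑e′ a h (a∈φ , a∉ψ) =
      h (⟦⟧-monotone φ X pφ e⊑e′ a a∈φ , a∉ψ ∘ ⟦⟧-antitone ψ X nψ e⊑e′ a)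
    ⟦⟧-antitone (ex y φ) X nφ e⊑e′ a (b , a∈φ) =
      b , ⟦⟧-antitone φ X nφ (⊑-updateₑ y b e⊑e′) a a∈φ
    ⟦⟧-antitone (mu Y φ) X nφ e⊑e′ with Y ≡ᵇ X in eq
    ... | true  = proj₂ (⟦⟧-agree (mu Y φ) (⊑⇒agreeOn (mu Y φ) e⊑e′ λ (Y≢X , _) → Y≢X (≡ᵇ-true⇒≡ eq)))
    ... | false = λ a m B closed → m B λ b b∈φ →
      closed b (⟦⟧-antitone φ X nφ (⊑-updateₛ Y B (≡ᵇ-false⇒≢ eq) e⊑e′) b b∈φ)

  -- Classical reasoning about the derived connectives

  ⊥ᵖ-empty : ∀ e a → ¬ ⟦ ⊥ᵖ ⟧ e a
  ⊥ᵖ-empty e a a∈⊥ with a∈⊥ (λ _ → false) (λ _ b∈∅ → b∈∅)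
  ... | ()

  ⇒-intro : ∀ φ ψ {e a} → (⟦ φ ⟧ e a → ⟦ ψ ⟧ e a) → ⟦ φ ⇒ ψ ⟧ e a
  ⇒-intro φ ψ f (a∈φ , a∉ψ) = a∉ψ (f a∈φ)

  ⇒-elim : ∀ φ ψ {e a} → ⟦ φ ⇒ ψ ⟧ e a → ⟦ φ ⟧ e a → ⟦ ψ ⟧ e a
  ⇒-elim φ ψ h a∈φ = dne λ a∉ψ → h (a∈φ , a∉ψ)

  ¬ᵖ-intro : ∀ φ {e a} → ¬ ⟦ φ ⟧ e a → ⟦ ¬ᵖ φ ⟧ e a
  ¬ᵖ-intro φ a∉φ (a∈φ , _) = a∉φ a∈φ

  ¬ᵖ-elim : ∀ φ {e a} → ⟦ ¬ᵖ φ ⟧ e a → ¬ ⟦ φ ⟧ e a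
  ¬ᵖ-elim φ {e} {a} h a∈φ = h (a∈φ , ⊥ᵖ-empty e a)

  ∨ᵖ-intro₁ : ∀ φ ψ {e a} → ⟦ φ ⟧ e a → ⟦ φ ∨ᵖ ψ ⟧ e a
  ∨ᵖ-intro₁ φ ψ a∈φ = ⇒-intro (¬ᵖ φ) ψ λ a∈¬φ → ⊥-elim (¬ᵖ-elim φ a∈¬φ a∈φ)

  ∨ᵖ-intro₂ : ∀ φ ψ {e a} → ⟦ ψ ⟧ e a → ⟦ φ ∨ᵖ ψ ⟧ e a
  ∨ᵖ-intro₂ φ ψ a∈ψ = ⇒-intro (¬ᵖ φ) ψ λ _ → a∈ψ

  ∨ᵖ-elim : ∀ φ ψ {e a} → ⟦ φ ∨ᵖ ψ ⟧ e a → ⟦ φ ⟧ e a ⊎ ⟦ ψ ⟧ e a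
  ∨ᵖ-elim φ ψ {e} {a} h with em {⟦ φ ⟧ e a}
  ... | yes a∈φ = inj₁ a∈φ
  ... | no a∉φ  = inj₂ (⇒-elim (¬ᵖ φ) ψ h (¬ᵖ-intro φ a∉φ))

  ∧ᵖ-elim : ∀ φ ψ {e a} → ⟦ φ ∧ᵖ ψ ⟧ e a → ⟦ φ ⟧ e a × ⟦ ψ ⟧ e a
  ∧ᵖ-elim φ ψ h =
    dne (λ a∉φ → ¬ᵖ-elim ((¬ᵖ φ) ∨ᵖ (¬ᵖ ψ)) h (∨ᵖ-intro₁ (¬ᵖ φ) (¬ᵖ ψ) (¬ᵖ-intro φ a∉φ))) ,
    dne (λ a∉ψ → ¬ᵖ-elim ((¬ᵖ φ) ∨ᵖ (¬ᵖ ψ)) h (∨ᵖ-intro₂ (¬ᵖ φ) (¬ᵖ ψ) (¬ᵖ-intro ψ a∉ψ)))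

  ⟦⟧ᵇ-⇒ : ∀ φ ψ e a → ⟦ φ ⇒ ψ ⟧ᵇ e a ≡ not (⟦ φ ⟧ᵇ e a ∧ not (⟦ ψ ⟧ᵇ e a))
  ⟦⟧ᵇ-⇒ φ ψ e a with em {⟦ φ ⟧ e a} | em {⟦ ψ ⟧ e a}
  ... | yes a∈φ | yes a∈ψ = ⌊⌋-true (⇒-intro φ ψ λ _ → a∈ψ)
  ... | yes a∈φ | no a∉ψ  = ⌊⌋-false λ h → a∉ψ (⇒-elim φ ψ h a∈φ)
  ... | no a∉φ  | _       = ⌊⌋-true (⇒-intro φ ψ λ a∈φ → ⊥-elim (a∉φ a∈φ))

  -- Soundness of the axioms and rules

  valid-⇒ : ∀ φ ψ → (∀ e → ⟦ φ ⟧ e ⊆′ ⟦ ψ ⟧ e) → Valid M (φ ⇒ ψ)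
  valid-⇒ φ ψ φ⊆ψ e a = ⇒-intro φ ψ (φ⊆ψ e a)

  valid-⇒⁻¹ : ∀ φ ψ → Valid M (φ ⇒ ψ) → ∀ e → ⟦ φ ⟧ e ⊆′ ⟦ ψ ⟧ e
  valid-⇒⁻¹ φ ψ valid e a = ⇒-elim φ ψ (valid e a)

  ∙-∨ᵖˡ : ∀ φ ψ χ e → ⟦ (φ ∨ᵖ ψ) ∙ χ ⟧ e ⊆′ ⟦ (φ ∙ χ) ∨ᵖ (ψ ∙ χ) ⟧ e
  ∙-∨ᵖˡ φ ψ χ e a (b , c , b∈φ∨ψ , c∈χ , bc∋a) =
    [ (λ b∈φ → ∨ᵖ-intro₁ (φ ∙ χ) (ψ ∙ χ) (b , c , b∈φ , c∈χ , bc∋a)) ,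
      (λ b∈ψ → ∨ᵖ-intro₂ (φ ∙ χ) (ψ ∙ χ) (b , c , b∈ψ , c∈χ , bc∋a)) ] (∨ᵖ-elim φ ψ b∈φ∨ψ)

  ∙-∨ᵖʳ : ∀ φ ψ χ e → ⟦ χ ∙ (φ ∨ᵖ ψ) ⟧ e ⊆′ ⟦ (χ ∙ φ) ∨ᵖ (χ ∙ ψ) ⟧ e
  ∙-∨ᵖʳ φ ψ χ e a (b , c , b∈χ , c∈φ∨ψ , bc∋a) =
    [ (λ c∈φ → ∨ᵖ-intro₁ (χ ∙ φ) (χ ∙ ψ) (b , c , b∈χ , c∈φ , bc∋a)) ,
      (λ c∈ψ → ∨ᵖ-intro₂ (χ ∙ φ) (χ ∙ ψ) (b , c , b∈χ , c∈ψ , bc∋a)) ] (∨ᵖ-elim φ ψ c∈φ∨ψ)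

  plug-nonempty : ∀ C δ {e a} → ⟦ plug C δ ⟧ e a → ∃[ b ] ⟦ δ ⟧ e b
  plug-nonempty □ δ a∈δ = _ , a∈δ
  plug-nonempty (C ·ₗ φ) δ (b , _ , b∈C , _) = plug-nonempty C δ b∈C
  plug-nonempty (φ ·ᵣ C) δ (_ , c , _ , c∈C , _) = plug-nonempty C δ c∈C

  singleton-variable : ∀ x φ C₁ C₂ e a →
                       ⟦ ¬ᵖ (plug C₁ (evar x ∧ᵖ φ) ∧ᵖ plug C₂ (evar x ∧ᵖ (¬ᵖ φ))) ⟧ e a
  singleton-variable x φ C₁ C₂ e a = ¬ᵖ-intro (plug C₁ (evar x ∧ᵖ φ) ∧ᵖ plug C₂ (evar x ∧ᵖ (¬ᵖ φ))) λ h →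
    let a∈C₁ , a∈C₂ = ∧ᵖ-elim (plug C₁ (evar x ∧ᵖ φ)) (plug C₂ (evar x ∧ᵖ (¬ᵖ φ))) h
        b , b∈x∧φ   = plug-nonempty C₁ (evar x ∧ᵖ φ) a∈C₁
        c , c∈x∧¬φ  = plug-nonempty C₂ (evar x ∧ᵖ (¬ᵖ φ)) a∈C₂
        b≡x , b∈φ   = ∧ᵖ-elim (evar x) φ b∈x∧φ
        c≡x , c∈¬φ  = ∧ᵖ-elim (evar x) (¬ᵖ φ) c∈x∧¬φ
    in ¬ᵖ-elim φ c∈¬φ (subst (⟦ φ ⟧ e) (≡.trans b≡x (≡.sym c≡x)) b∈φ)

  mu-prefixpoint : ∀ φ X e → Positive X φ → SFreeFor X (mu X φ) φ →
                   ⟦ ssubst X (mu X φ) φ ⟧ e ⊆′ ⟦ mu X φ ⟧ e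
  mu-prefixpoint φ X e pos free a a∈φ[μ] B closed =
    closed a (⟦⟧-monotone φ X pos (⊑-enlarge e X μ⊆B) a (proj₁ (⟦⟧-ssubst φ X (mu X φ) e free) a a∈φ[μ]))
    where
    μ⊆B : ⟦ mu X φ ⟧ᵇ e ⊆ᵇ B
    μ⊆B b b∈μ = ⌊⌋-true⁻¹ b∈μ B closed

  mu-least : ∀ φ ψ X e → SFreeFor X ψ φ → ⟦ ssubst X ψ φ ⟧ e ⊆′ ⟦ ψ ⟧ e → ⟦ mu X φ ⟧ e ⊆′ ⟦ ψ ⟧ e
  mu-least φ ψ X e free ψ-closed a a∈μ =
    ⌊⌋-true⁻¹ (a∈μ (⟦ ψ ⟧ᵇ e) λ b b∈φ[ψ] →
      ⌊⌋-true (ψ-closed b (proj₂ (⟦⟧-ssubst φ X ψ e free) b b∈φ[ψ])))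

  sound : ∀ {Γ φ} → Γ ⊢ φ → (∀ γ → Γ γ → Valid M γ) → Valid M φ
  sound (hyp γ∈Γ) ⊨Γ = ⊨Γ _ γ∈Γ
  sound (taut tautology) _ e =
    ⌊⌋-true⁻¹ ∘ tautology M (λ ψ → ⟦ ψ ⟧ᵇ e) (⌊⌋-false ∘ ⊥ᵖ-empty e) (λ ψ χ → ⟦⟧ᵇ-⇒ ψ χ e)
  sound (∃-quant {φ} {x} {y} free) _ =
    valid-⇒ _ (ex x φ) λ e a a∈φ[y] → ev e y , proj₁ (⟦⟧-esubst φ x y e free) a a∈φ[y]
  sound (prop⊥ₗ {φ}) _ = valid-⇒ (⊥ᵖ ∙ φ) ⊥ᵖ λ e a (b , _ , b∈⊥ , _) → ⊥-elim (⊥ᵖ-empty e b b∈⊥)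
  sound (prop⊥ᵣ {φ}) _ = valid-⇒ (φ ∙ ⊥ᵖ) ⊥ᵖ λ e a (_ , c , _ , c∈⊥ , _) → ⊥-elim (⊥ᵖ-empty e c c∈⊥)
  sound (prop∨ₗ {φ} {ψ} {χ}) _ = valid-⇒ ((φ ∨ᵖ ψ) ∙ χ) ((φ ∙ χ) ∨ᵖ (ψ ∙ χ)) (∙-∨ᵖˡ φ ψ χ)
  sound (prop∨ᵣ {φ} {ψ} {χ}) _ = valid-⇒ (χ ∙ (φ ∨ᵖ ψ)) ((χ ∙ φ) ∨ᵖ (χ ∙ ψ)) (∙-∨ᵖʳ φ ψ χ)
  sound (prop∃ₗ {φ} {ψ} {x} x∉ψ) _ = valid-⇒ (ex x φ ∙ ψ) (ex x (φ ∙ ψ))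
    λ e a (b , c , (d , b∈φ) , c∈ψ , bc∋a) →
      d , b , c , b∈φ , proj₁ (⟦⟧-agree ψ (agreeOn-updateₑ-unused e d x∉ψ)) c c∈ψ , bc∋a
  sound (prop∃ᵣ {φ} {ψ} {x} x∉ψ) _ = valid-⇒ (ψ ∙ ex x φ) (ex x (ψ ∙ φ))
    λ e a (b , c , b∈ψ , (d , c∈φ) , bc∋a) →
      d , b , c , proj₁ (⟦⟧-agree ψ (agreeOn-updateₑ-unused e d x∉ψ)) b b∈ψ , c∈φ , bc∋a
  sound (prefix {φ} {X} pos free) _ = valid-⇒ _ (mu X φ) λ e → mu-prefixpoint φ X e pos free
  sound (existence {x}) _ e a = a , ≡.sym (lookup-updateₑ e a x)
  sound (singleton {x} {φ} C₁ C₂) _ = singleton-variable x φ C₁ C₂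
  sound (mp {φ} {ψ} ⊢φ ⊢φ⇒ψ) ⊨Γ e a = valid-⇒⁻¹ φ ψ (sound ⊢φ⇒ψ ⊨Γ) e a (sound ⊢φ ⊨Γ e a)
  sound (∃-rule {φ} {ψ} {x} x∉ψ ⊢φ⇒ψ) ⊨Γ = valid-⇒ (ex x φ) ψ λ e a (b , a∈φ) →
    proj₂ (⟦⟧-agree ψ (agreeOn-updateₑ-unused e b x∉ψ)) a
          (valid-⇒⁻¹ φ ψ (sound ⊢φ⇒ψ ⊨Γ) (e [ b /ₑ x ]) a a∈φ)
  sound (framingₗ {φ} {ψ} {χ} ⊢φ⇒ψ) ⊨Γ = valid-⇒ (φ ∙ χ) (ψ ∙ χ) λ e a (b , c , b∈φ , c∈χ , bc∋a) →
    b , c , valid-⇒⁻¹ φ ψ (sound ⊢φ⇒ψ ⊨Γ) e b b∈φ , c∈χ , bc∋a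
  sound (framingᵣ {φ} {ψ} {χ} ⊢φ⇒ψ) ⊨Γ = valid-⇒ (χ ∙ φ) (χ ∙ ψ) λ e a (b , c , b∈χ , c∈φ , bc∋a) →
    b , c , b∈χ , valid-⇒⁻¹ φ ψ (sound ⊢φ⇒ψ ⊨Γ) e c c∈φ , bc∋a
  sound (set-subst {φ} {ψ} {X} free ⊢φ) ⊨Γ e a =
    proj₂ (⟦⟧-ssubst φ X ψ e free) a (sound ⊢φ ⊨Γ (e [ ⟦ ψ ⟧ᵇ e /ₛ X ]) a)
  sound (knaster-tarski {φ} {ψ} {X} free ⊢φ[ψ]⇒ψ) ⊨Γ = valid-⇒ (mu X φ) ψ λ e →
    mu-least φ ψ X e free (valid-⇒⁻¹ (ssubst X ψ φ) ψ (sound ⊢φ[ψ]⇒ψ ⊨Γ) e)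

mainTheorem1 : ExcludedMiddle 0ℓ →
    {Sig : Set} (Γ : Pattern Sig → Set) (φ : Pattern Sig) →
    Γ ⊢ φ →
    (M : Structure Sig) →
    ((γ : Pattern Sig) → Γ γ → Valid M γ) →
    Valid M φ
mainTheorem1 em Γ φ ⊢φ M ⊨Γ = Soundness.sound em M ⊢φ ⊨Γ
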